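{- Let $I=(R,H,\succ,q,\mathcal{E},c)$ be an instance of the Hospitals/Residents problem with Regional Caps, and let $I'=(R,H,\succ,q',\mathcal{E},c)$ where $q'(h)=\min\{q(h),|\mathrm{AC}(h)|\}$ for each $h\in H$. Then a set $M\subseteq R\times H$ is a strongly stable matching of $I$ if and only if it is a strongly stable matching of $I'$.
   Context: An instance $I=(R,H,\succ,q,\mathcal{E},c)$ of the Hospitals/Residents problem with Regional Caps (HRRC) consists of a finite set $R$ of residents, a finite set $H$ of hospitals, for each agent $a\in R\cup H$ a strict preference order $\succ_a$ over a subset of the opposite side (the agents in it are acceptable to $a$; acceptability is mutual), capacities $q:H\to\mathbb{N}_0$, a set $\mathcal{E}\subseteq 2^H\setminus\{\emptyset\}$ of regions, and regional caps $c:\mathcal{E}\to\mathbb{N}_0$. $\mathrm{AC}(a)$ denotes the set of agents acceptable to $a$. A matching is a set $M\subseteq R\times H$ of mutually acceptable pairs such that each resident is in at most one pair and each hospital $h$ is in at most $q(h)$ pairs; $M(a)$ denotes the set of partners of $a$, $M(E)=\bigcup_{h\in E}M(h)$, and for an assigned resident $M(r)$ also denotes its hospital. $M$ is feasible if $|M(E)|\le c(E)$ for all $E\in\mathcal{E}$. A pair $(r,h)$ is a blocking pair for $M$ if it is acceptable, $r$ is unassigned or $h\succ_r M(r)$, and either $|M(h)|<q(h)$ or $r\succ_h r'$ for some $r'\in M(h)$. A blocking pair $(r,h)$ is a strong blocking pair if (i) $M\setminus\{(r,M(r))\}\cup\{(r,h)\}$ is feasible (where $M\setminus\{(r,M(r))\}=M$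 if $r$ is unassigned), or (ii) there exists $r'\in M(h)$ with $r\succ_h r'$. A feasible matching with no strong blocking pair is strongly stable. -}

module Defs where

open import Data.Nat using (ℕ; _≤_; _<_; _⊔_; _⊓_)
open import Data.Bool using (Bool; true; false; if_then_else_; _∧_)
open import Data.Fin using (Fin; _≟_)
import Data.Fin as F
open import Data.Fin.Subset using (Subset; ∣_∣; Nonempty)
import Data.Fin.Subset as S
import Data.Fin.Subset.Properties as SP
open import Data.Vec using (tabulate)
open import Data.List using (List; length; lookup)
open import Data.List.Relation.Unary.Unique.Propositional using (Unique)
import Data.List.Membership.Propositional as LM
open import Data.List.Relation.Unary.Any using (any?)
open import Data.Product using (Σ; ∃; _×_; _,_)
open import Data.Sum using (_⊎_)
open import Function.Bundles using (_⇔_)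
open import Function.Definitions using (Injective)
open import Relation.Binary.PropositionalEquality using (_≡_)
open import Relation.Nullary using (does)
open import Relation.Nullary.Decidable using (_×-dec_)
import Data.Fin.Properties as FP

-- Strict preference given by a rank list (earlier = more preferred):
-- x is strictly preferred to y in list l.
Prefers : ∀ {A : Set} → List A → A → A → Set
Prefers l x y = Σ (F.Fin (length l)) λ i → Σ (F.Fin (length l)) λ j →
  (i F.< j) × (lookup l i ≡ x) × (lookup l j ≡ y)

-- An HRRC instance. Residents are Fin nR, hospitals Fin nH,
-- regions are indexed by Fin nE (the set 𝓔 = image of `region`).
record Instance : Set where
  field
    nR nH nE : ℕ
    prefR    : Fin nR → List (Fin nH)   -- ≻_r on AC(r)
    prefH    : Fin nH → List (Fin nR)   -- ≻_h on AC(h)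
    prefR-unique : ∀ r → Unique (prefR r)
    prefH-unique : ∀ h → Unique (prefH h)
    mutualAC : ∀ r h → (h LM.∈ prefR r) ⇔ (r LM.∈ prefH h)
    cap      : Fin nH → ℕ
    region   : Fin nE → Subset nH
    region-nonempty : ∀ e → Nonempty (region e)
    region-distinct : Injective _≡_ _≡_ region
    rcap     : Fin nE → ℕ

module _ (I : Instance) where
  open Instance I

  PairSet : Set
  PairSet = Fin nR → Fin nH → Bool

  load : PairSet → Fin nH → ℕ
  load M h = ∣ tabulate (λ r → M r h) ∣

  regionLoad : PairSet → Subset nH → ℕ
  regionLoad M E = ∣ tabulate (λ r → does (FP.any? (λ h → (h SP.∈? E) ×-dec (M r h Data.Bool.≟ true)))) ∣
    where import Data.Bool

  IsMatching : PairSet → Set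
  IsMatching M =
      (∀ r h → M r h ≡ true → h LM.∈ prefR r)
    × (∀ r h h′ → M r h ≡ true → M r h′ ≡ true → h ≡ h′)
    × (∀ h → load M h ≤ cap h)

  CapsOK : PairSet → Set
  CapsOK M = ∀ e → regionLoad M (region e) ≤ rcap e

  Feasible : PairSet → Set
  Feasible M = IsMatching M × CapsOK M

  Unassigned : PairSet → Fin nR → Set
  Unassigned M r = ∀ h → M r h ≡ false

  reassign : PairSet → Fin nR → Fin nH → PairSet
  reassign M r h r′ h′ = if does (r′ ≟ r) then does (h′ ≟ h) else M r′ h′

  BlockingPair : PairSet → Fin nR → Fin nH → Set
  BlockingPair M r h =
      (h LM.∈ prefR r)
    × (Unassigned M r ⊎ (Σ (Fin nH) λ h′ → (M r h′ ≡ true) × Prefers (prefR r) h h′))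
    × (load M h < cap h ⊎ (Σ (Fin nR) λ r′ → (M r′ h ≡ true) × Prefers (prefH h) r r′))

  StrongBlockingPair : PairSet → Fin nR → Fin nH → Set
  StrongBlockingPair M r h =
      BlockingPair M r h
    × (CapsOK (reassign M r h)
       ⊎ (Σ (Fin nR) λ r′ → (M r′ h ≡ true) × Prefers (prefH h) r r′))

  StronglyStable : PairSet → Set
  StronglyStable M = Feasible M × (∀ r h → StrongBlockingPair M r h → Data.Empty.⊥)
    where import Data.Empty

trimCaps : Instance → Instance
trimCaps I = record I { cap = λ h → cap h ⊓ length (prefH h) }
  where open Instance I

-- A matching of I never fills a hospital h beyond |AC(h)|, since every resident
-- assigned to h is acceptable to h; so matchings of I and I′ coincide. In a
-- blocking pair (r, h) the resident r is acceptable to h but not assigned to it,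
-- so |M(h)| < |AC(h)|, and hence |M(h)| < q(h) iff |M(h)| < q′(h): the
-- blocking pairs, and with them the strong blocking pairs, coincide as well.
module Submission where

open import Defs
open import Function.Base using (_∘_)
open import Function.Bundles using (_⇔_; mk⇔; Equivalence)
open import Data.Nat using (_≤_; _<_; _+_; _⊓_; z≤n; s≤s)
open import Data.Nat.Properties
  using (≤-trans; ≤-reflexive; <-≤-trans; +-suc; +-monoʳ-≤; ⊓-glb; m⊓n≤m; m<n⊓o⇒m<n)
open import Data.Bool using (Bool; true; false)
open import Data.Bool.Properties using (not-¬)
open import Data.Fin using (Fin; zero; suc)
open import Data.Fin.Properties using (<-irrefl)
open import Data.Fin.Subset using (Subset; ∣_∣; _∪_; ⁅_⁆; ⋃; inside; outside; _∈_; _∉_)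
open import Data.Fin.Subset.Properties
  using (∣p∣≤∣x∷p∣; ∣⊥∣≡0; ∣⁅x⁆∣≡1; x∈⁅x⁆; x∈p∪q⁺; p⊆q⇒∣p∣≤∣q∣; p⊂q⇒∣p∣<∣q∣)
open import Data.Vec using ([]; _∷_; tabulate)
open import Data.Vec.Properties using ([]=⇒lookup; lookup∘tabulate)
open import Data.List using (List; length; lookup)
import Data.List as List
open import Data.List.Relation.Unary.Any using (here; there)
import Data.List.Relation.Unary.All as All
open import Data.List.Relation.Unary.AllPairs using (_∷_)
open import Data.List.Membership.Propositional using () renaming (_∈_ to _∈ₗ_)
open import Data.List.Membership.Propositional.Properties using (∈-lookup)
open import Data.List.Relation.Unary.Unique.Propositional using (Unique)
open import Data.Product using (Σ; _×_; _,_)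
open import Data.Sum using (_⊎_; inj₁; inj₂)
import Data.Sum as Sum
open import Data.Empty using (⊥-elim)
open import Relation.Binary.PropositionalEquality using (_≡_; _≢_; refl; sym; trans; cong)

∣p∪q∣≤∣p∣+∣q∣ : ∀ {n} (p q : Subset n) → ∣ p ∪ q ∣ ≤ ∣ p ∣ + ∣ q ∣
∣p∪q∣≤∣p∣+∣q∣ []            []            = z≤n
∣p∪q∣≤∣p∣+∣q∣ (inside ∷ p)  (x ∷ q)       =
  s≤s (≤-trans (∣p∪q∣≤∣p∣+∣q∣ p q) (+-monoʳ-≤ ∣ p ∣ (∣p∣≤∣x∷p∣ x q)))
∣p∪q∣≤∣p∣+∣q∣ (outside ∷ p) (inside ∷ q)  =
  ≤-trans (s≤s (∣p∪q∣≤∣p∣+∣q∣ p q)) (≤-reflexive (sym (+-suc ∣ p ∣ ∣ q ∣)))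
∣p∪q∣≤∣p∣+∣q∣ (outside ∷ p) (outside ∷ q) = ∣p∪q∣≤∣p∣+∣q∣ p q

fromList : ∀ {n} → List (Fin n) → Subset n
fromList xs = ⋃ (List.map ⁅_⁆ xs)

∣fromList∣≤length : ∀ {n} (xs : List (Fin n)) → ∣ fromList xs ∣ ≤ length xs
∣fromList∣≤length {n} List.[] = ≤-reflexive (∣⊥∣≡0 n)
∣fromList∣≤length (x List.∷ xs) = ≤-trans (∣p∪q∣≤∣p∣+∣q∣ ⁅ x ⁆ (fromList xs))
  (≤-trans (+-monoʳ-≤ ∣ ⁅ x ⁆ ∣ (∣fromList∣≤length xs)) (≤-reflexive (cong (_+ length xs) (∣⁅x⁆∣≡1 x))))

∈fromList⁺ : ∀ {n} {x : Fin n} {xs} → x ∈ₗ xs → x ∈ fromList xs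
∈fromList⁺ {x = x} (here refl) = x∈p∪q⁺ (inj₁ (x∈⁅x⁆ x))
∈fromList⁺ (there x∈xs) = x∈p∪q⁺ (inj₂ (∈fromList⁺ x∈xs))

module _ {n} {p : Subset n} {xs : List (Fin n)} (p⊆xs : ∀ {x} → x ∈ p → x ∈ₗ xs) where

  ∣p∣≤length : ∣ p ∣ ≤ length xs
  ∣p∣≤length = ≤-trans (p⊆q⇒∣p∣≤∣q∣ (∈fromList⁺ ∘ p⊆xs)) (∣fromList∣≤length xs)

  ∣p∣<length : ∀ {x} → x ∈ₗ xs → x ∉ p → ∣ p ∣ < length xs
  ∣p∣<length {x} x∈xs x∉p =
    <-≤-trans (p⊂q⇒∣p∣<∣q∣ ((∈fromList⁺ ∘ p⊆xs) , x , ∈fromList⁺ x∈xs , x∉p))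
              (∣fromList∣≤length xs)

∈tabulate⁻ : ∀ {n} (f : Fin n → Bool) {x} → x ∈ tabulate f → f x ≡ true
∈tabulate⁻ f {x} x∈ = trans (sym (lookup∘tabulate f x)) ([]=⇒lookup x∈)

∉tabulate⁺ : ∀ {n} (f : Fin n → Bool) {x} → f x ≡ false → x ∉ tabulate f
∉tabulate⁺ f fx≡false x∈ = not-¬ (∈tabulate⁻ f x∈) fx≡false

Unique⇒lookup-injective : ∀ {A : Set} {xs : List A} → Unique xs →
  ∀ i j → lookup xs i ≡ lookup xs j → i ≡ j
Unique⇒lookup-injective (_ ∷ _) zero zero _ = refl
Unique⇒lookup-injective (x∉ ∷ _) zero (suc j) eq = ⊥-elim (All.lookup x∉ (∈-lookup j) eq)
Unique⇒lookup-injective (x∉ ∷ _) (suc i) zero eq = ⊥-elim (All.lookup x∉ (∈-lookup i) (sym eq))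
Unique⇒lookup-injective (_ ∷ u) (suc i) (suc j) eq = cong suc (Unique⇒lookup-injective u i j eq)

Prefers⇒≢ : ∀ {A : Set} {xs : List A} {x y} → Unique xs → Prefers xs x y → x ≢ y
Prefers⇒≢ u (i , j , i<j , refl , refl) eq =
  <-irrefl (Unique⇒lookup-injective u i j eq) i<j

m<o⇒m<n⇔m<n⊓o : ∀ {m n o} → m < o → (m < n) ⇔ (m < n ⊓ o)
m<o⇒m<n⇔m<n⊓o {n = n} m<o = mk⇔ (λ m<n → ⊓-glb m<n m<o) (m<n⊓o⇒m<n n _)

module _ (I : Instance) (M : PairSet I) where
  open Instance I

  Acceptable : Set
  Acceptable = ∀ r h → M r h ≡ true → h ∈ₗ prefR r

  ResidentPrefers : Fin nR → Fin nH → Set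
  ResidentPrefers r h = Unassigned I M r ⊎ Σ (Fin nH) λ h′ → (M r h′ ≡ true) × Prefers (prefR r) h h′

  module _ (acceptable : Acceptable) (h : Fin nH) where

    assigned⊆AC : ∀ {r} → r ∈ tabulate (λ r → M r h) → r ∈ₗ prefH h
    assigned⊆AC {r} r∈ = Equivalence.to (mutualAC r h) (acceptable r h (∈tabulate⁻ (λ r → M r h) r∈))

    load≤∣AC∣ : load I M h ≤ length (prefH h)
    load≤∣AC∣ = ∣p∣≤length assigned⊆AC

    load<∣AC∣ : ∀ {r} → r ∈ₗ prefH h → M r h ≡ false → load I M h < length (prefH h)
    load<∣AC∣ r∈AC Mrh≡false = ∣p∣<length assigned⊆AC r∈AC (∉tabulate⁺ (λ r → M r h) Mrh≡false)

  ResidentPrefers⇒unassigned : IsMatching I M → ∀ {r h} → ResidentPrefers r h → M r h ≡ false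
  ResidentPrefers⇒unassigned _ (inj₁ unassigned) = unassigned _
  ResidentPrefers⇒unassigned (_ , functional , _) {r} {h} (inj₂ (h′ , Mrh′ , h≻h′)) with M r h in Mrh
  ... | false = refl
  ... | true  = ⊥-elim (Prefers⇒≢ (prefR-unique r) h≻h′ (functional r h h′ Mrh Mrh′))

  IsMatching⇔trim : IsMatching I M ⇔ IsMatching (trimCaps I) M
  IsMatching⇔trim = mk⇔
    (λ (acc , fun , load≤q) → acc , fun , λ h → ⊓-glb (load≤q h) (load≤∣AC∣ acc h))
    (λ (acc , fun , load≤q′) → acc , fun , λ h → ≤-trans (load≤q′ h) (m⊓n≤m _ _))

  BlockingPair⇔trim : IsMatching I M → ∀ r h → BlockingPair I M r h ⇔ BlockingPair (trimCaps I) M r h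
  BlockingPair⇔trim matching@(acc , _) r h = mk⇔
    (λ (h∈AC , prefers , hospital) → h∈AC , prefers , Sum.map₁ (Equivalence.to (q⇔q′ h∈AC prefers)) hospital)
    (λ (h∈AC , prefers , hospital) → h∈AC , prefers , Sum.map₁ (Equivalence.from (q⇔q′ h∈AC prefers)) hospital)
    where
    q⇔q′ : h ∈ₗ prefR r → ResidentPrefers r h → (load I M h < cap h) ⇔ (load I M h < cap h ⊓ length (prefH h))
    q⇔q′ h∈AC prefers = m<o⇒m<n⇔m<n⊓o
      (load<∣AC∣ acc h (Equivalence.to (mutualAC r h) h∈AC) (ResidentPrefers⇒unassigned matching prefers))

lemma1 : (I : Instance) (M : PairSet I) →
    StronglyStable I M ⇔ StronglyStable (trimCaps I) M
lemma1 I M = mk⇔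
  (λ ((matching , caps) , stable) →
     (Equivalence.to (IsMatching⇔trim I M) matching , caps) ,
     λ r h (blocking , strong) → stable r h (Equivalence.from (BlockingPair⇔trim I M matching r h) blocking , strong))
  (λ ((matching′ , caps) , stable) →
     let matching = Equivalence.from (IsMatching⇔trim I M) matching′ in
     (matching , caps) ,
     λ r h (blocking , strong) → stable r h (Equivalence.to (BlockingPair⇔trim I M matching r h) blocking , strong))
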